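{- The number of pieces $R$ in the total dual class function $U_{\langle v_1,\dots,v_N\rangle}(\cdot)$ is at most $O(N^2K\min\{N,K\})$.
   Context: A seller has $K$ identical units of an item. Sample $i\in[N]$ is given by a valuation $v_i:\{1,\dots,K\}\to\mathbb{R}_{\ge0}$ (with value $0$ for buying nothing). A two-part tariff is $\rho=(p_1,p_2)$ with $p_1,p_2\ge0$: buying $q\ge1$ units costs $p_1+p_2q$. In sample $i$ the buyer purchases a quantity $q\in\{1,\dots,K\}$ maximizing $v_i(q)-(p_1+p_2q)$, and zero units if this is negative for every $q>0$. The revenue from sample $i$ is $0$ if nothing is bought and $p_1+p_2q$ if $q>0$ units are bought; $U_{\langle v_1,\dots,v_N\rangle}(\rho)$ is the total revenue over the $N$ samples. Its pieces are the distinct regions of the $(p_1,p_2)$ space on which the buyer's purchased quantity in every sample is fixed. -}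

module Defs where

open import Level using (0ℓ)
open import Data.Nat as ℕ using (ℕ; zero; suc)
open import Data.Fin using (Fin; zero; suc; toℕ)
open import Data.Product using (_×_; ∃; _,_)
open import Relation.Nullary using (¬_)
open import Relation.Binary.PropositionalEquality using (_≡_)
open import Relation.Binary.Structures using (IsTotalOrder)
open import Algebra.Structures using (IsCommutativeRing)

-- An ordered field (with propositional equality).  ℝ is an instance;
-- the paper's statement is the instance F = ℝ.
record OrderedField : Set₁ where
  infixl 6 _+_
  infixl 7 _*_
  infix 4 _≤_
  field
    Carrier : Set
    _+_ _*_ : Carrier → Carrier → Carrier
    -_      : Carrier → Carrier
    0# 1#   : Carrier
    _≤_     : Carrier → Carrier → Set
    isCommutativeRing : IsCommutativeRing _≡_ _+_ _*_ -_ 0# 1#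
    isTotalOrder      : IsTotalOrder _≡_ _≤_
    +-mono-≤  : ∀ {a b} c → a ≤ b → a + c ≤ b + c
    *-nonneg  : ∀ {a b} → 0# ≤ a → 0# ≤ b → 0# ≤ a * b
    0≢1       : ¬ (0# ≡ 1#)
    inverse   : ∀ a → ¬ (a ≡ 0#) → ∃ λ b → a * b ≡ 1#

module Tariff (F : OrderedField) where
  open OrderedField F

  infix 4 _<_
  _<_ : Carrier → Carrier → Set
  a < b = (a ≤ b) × ¬ (a ≡ b)

  _-_ : Carrier → Carrier → Carrier
  a - b = a + (- b)

  fromℕ : ℕ → Carrier
  fromℕ zero    = 0#
  fromℕ (suc n) = 1# + fromℕ n

  -- A valuation on {1,…,K}: index j : Fin K stands for the quantity toℕ j + 1.
  Valuation : ℕ → Set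
  Valuation K = Fin K → Carrier

  qty : ∀ {K} → Fin K → ℕ
  qty j = suc (toℕ j)

  Tariff : Set
  Tariff = Carrier × Carrier

  price : Tariff → ℕ → Carrier
  price (p₁ , p₂) q = p₁ + p₂ * fromℕ q

  utility : ∀ {K} → Valuation K → Tariff → Fin K → Carrier
  utility v ρ j = v j - price ρ (qty j)

  -- Buys v ρ q : under tariff ρ the buyer with valuation v purchases
  -- q units, where q : Fin (suc K) (zero = nothing bought, suc j = qty j units).
  data Buys {K : ℕ} (v : Valuation K) (ρ : Tariff) : Fin (suc K) → Set where
    buy-nothing : (∀ j → utility v ρ j < 0#) → Buys v ρ zero
    buy-some    : ∀ j →
                  0# ≤ utility v ρ j →
                  (∀ j' → utility v ρ j' ≤ utility v ρ j) →
                  (∀ j' → toℕ j' ℕ.< toℕ j → utility v ρ j' < utility v ρ j) →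
                  Buys v ρ (suc j)

  revenue : ∀ {K} → Tariff → Fin (suc K) → Carrier
  revenue ρ zero    = 0#
  revenue ρ (suc j) = price ρ (qty j)

  ValidTariff : Tariff → Set
  ValidTariff (p₁ , p₂) = (0# ≤ p₁) × (0# ≤ p₂)

  -- "The number of pieces of U_⟨v₁,…,v_N⟩ is at most B":
  -- any family of m valid tariffs whose purchase profiles (the purchased
  -- quantity in every sample) are pairwise distinct has m ≤ B.
  PiecesAtMost : ∀ {N K} → (Fin N → Valuation K) → ℕ → Set
  PiecesAtMost {N} {K} vs B =
    ∀ (m : ℕ) (ρs : Fin m → Tariff) (qs : Fin m → Fin N → Fin (suc K)) →
    (∀ a → ValidTariff (ρs a)) →
    (∀ a i → Buys (vs i) (ρs a) (qs a i)) →
    (∀ a b → (∀ i → qs a i ≡ qs b i) → a ≡ b) →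
    m ℕ.≤ B

{-# OPTIONS --safe #-}
-- Order the tariffs by unit price p₂. For every sample the least utility-maximising quantity (its
-- optimum) is antitone in p₂, and it is bought iff its surplus is at least that of a marginal buyer k,
-- a buyer of least surplus. Utility differences are affine in p₂ with slope a difference of
-- quantities, so among tariffs with the same marginal buyer and the same optima each comparison
-- with k flips at most once, in a direction fixed by the order of the two optima. Hence a
-- lexicographic rank per sample is antitone in p₂, and tariffs with the same marginal buyer and the
-- same rank sum have the same purchase profile. A profile is thus determined by k and a rank sum
-- of size O(NK), which gives O(N²K) pieces.
module Submission where

open import Defs
open import Level using (Level)
open import Data.Bool as Bool using (Bool; true; false; not; _xor_)
open import Data.Maybe using (nothing)
open import Data.Nat as ℕ using (ℕ; zero; suc; z≤n; s≤s)
import Data.Nat.Properties as ℕ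
open import Data.Nat.Tactic.RingSolver using (solve-∀)
open import Data.Fin as Fin using (Fin; zero; suc; toℕ)
import Data.Fin.Properties as Fin
open import Data.Bool.Properties using (not-injective)
open import Data.Product using (∃; _×_; _,_; proj₁; proj₂)
open import Data.Sum using (_⊎_; inj₁; inj₂)
open import Function using (_∘_; _⇔_; mk⇔; Equivalence)
open import Relation.Nullary using (¬_; Dec; yes; no; contradiction)
open import Relation.Nullary.Decidable using (⌊_⌋; ¬¬-excluded-middle; decidable-stable)
open import Relation.Nullary.Negation using (¬¬-map)
open import Relation.Binary.Core using (Rel)
open import Relation.Binary.Definitions using (tri<; tri≈; tri>)
open import Relation.Binary.PropositionalEquality
open import Relation.Binary.Structures using (IsTotalOrder)
open import Relation.Binary.Bundles using (TotalOrder)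
open import Algebra.Bundles using (CommutativeRing)
open import Algebra.Definitions.RawMonoid ℕ.+-0-rawMonoid using (sum)
open import Tactic.RingSolver.Core.AlmostCommutativeRing using (fromCommutativeRing)

module NatLemmas where

  open import Data.Nat using (_+_; _*_)

  equal-sums⇒equal-summands : ∀ {x x′ y y′} → x′ ℕ.≤ x → y′ ℕ.≤ y →
                              x′ + y′ ≡ x + y → x′ ≡ x × y′ ≡ y
  equal-sums⇒equal-summands {x} {x′} {y} {y′} x′≤x y′≤y eq with ℕ.m≤n⇒m<n∨m≡n x′≤x
  ... | inj₁ x′<x = contradiction eq (ℕ.<⇒≢ (ℕ.+-mono-<-≤ x′<x y′≤y))
  ... | inj₂ refl = refl , ℕ.+-cancelˡ-≡ x y′ y eq

  sum-mono-≤ : ∀ {n} {f g : Fin n → ℕ} → (∀ i → f i ℕ.≤ g i) → sum f ℕ.≤ sum g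
  sum-mono-≤ {zero}  f≤g = z≤n
  sum-mono-≤ {suc n} f≤g = ℕ.+-mono-≤ (f≤g zero) (sum-mono-≤ (f≤g ∘ suc))

  sum-≤ : ∀ {n} {f : Fin n → ℕ} {c} → (∀ i → f i ℕ.≤ c) → sum f ℕ.≤ n * c
  sum-≤ {zero}  f≤c = z≤n
  sum-≤ {suc n} f≤c = ℕ.+-mono-≤ (f≤c zero) (sum-≤ (f≤c ∘ suc))

  sum-≡⇒≡ : ∀ {n} {f g : Fin n → ℕ} → (∀ i → f i ℕ.≤ g i) → sum f ≡ sum g → ∀ i → f i ≡ g i
  sum-≡⇒≡ {suc n} f≤g eq zero    = proj₁ (equal-sums⇒equal-summands (f≤g zero) (sum-mono-≤ (f≤g ∘ suc)) eq)
  sum-≡⇒≡ {suc n} f≤g eq (suc i) =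
    sum-≡⇒≡ (f≤g ∘ suc) (proj₂ (equal-sums⇒equal-summands (f≤g zero) (sum-mono-≤ (f≤g ∘ suc)) eq)) i

  lexRank : ℕ → Bool → ℕ
  lexRank s false = 2 * s
  lexRank s true  = suc (2 * s)

  lexRank-≤ : ∀ s b → lexRank s b ℕ.≤ suc (2 * s)
  lexRank-≤ s false = ℕ.n≤1+n (2 * s)
  lexRank-≤ s true  = ℕ.≤-refl

  lexRank-< : ∀ {s s′} b b′ → s′ ℕ.< s → lexRank s′ b′ ℕ.< lexRank s b
  lexRank-< {s} {s′} b b′ s′<s = begin-strict
    lexRank s′ b′  ≤⟨ lexRank-≤ s′ b′ ⟩
    suc (2 * s′)   <⟨ ℕ.n<1+n _ ⟩
    2 + 2 * s′     ≡⟨ ℕ.*-suc 2 s′ ⟨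
    2 * suc s′     ≤⟨ ℕ.*-monoʳ-≤ 2 s′<s ⟩
    2 * s          ≤⟨ lexRank-≥ s b ⟩
    lexRank s b    ∎
    where
    open ℕ.≤-Reasoning
    lexRank-≥ : ∀ s b → 2 * s ℕ.≤ lexRank s b
    lexRank-≥ s false = ℕ.≤-refl
    lexRank-≥ s true  = ℕ.n≤1+n (2 * s)

  lexRank-mono : ∀ {s s′ b b′} → s′ ℕ.≤ s → (s′ ≡ s → b′ Bool.≤ b) → lexRank s′ b′ ℕ.≤ lexRank s b
  lexRank-mono {b = b} {b′} s′≤s b′≤b with ℕ.m≤n⇒m<n∨m≡n s′≤s
  ... | inj₁ s′<s = ℕ.<⇒≤ (lexRank-< b b′ s′<s)
  ... | inj₂ refl with b′≤b refl
  ...   | Bool.b≤b = ℕ.≤-refl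
  ...   | Bool.f≤t = ℕ.n≤1+n _

  lexRank-reflects : ∀ {s s′ b b′} → s′ ℕ.≤ s → lexRank s′ b′ ≡ lexRank s b → s′ ≡ s × b′ ≡ b
  lexRank-reflects {b = b} {b′} s′≤s eq with ℕ.m≤n⇒m<n∨m≡n s′≤s
  ... | inj₁ s′<s = contradiction eq (ℕ.<⇒≢ (lexRank-< b b′ s′<s))
  ... | inj₂ refl = refl , lexRank-injectiveʳ b′ b eq
    where
    lexRank-injectiveʳ : ∀ {s} b′ b → lexRank s b′ ≡ lexRank s b → b′ ≡ b
    lexRank-injectiveʳ false false _  = refl
    lexRank-injectiveʳ true  true  _  = refl
    lexRank-injectiveʳ false true  eq = contradiction (sym eq) ℕ.1+n≢n
    lexRank-injectiveʳ true  false eq = contradiction eq ℕ.1+n≢n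

  profileBound : ℕ → ℕ → ℕ
  profileBound N K = suc (N * suc (N * suc (2 * (K + K))))

  profileBound-≤ : ∀ n K → profileBound (suc n) K ℕ.≤ 4 * (suc n * suc n * suc K * (suc n ℕ.⊓ suc K))
  profileBound-≤ n K = begin
    profileBound N K                  ≡⟨ expand N K ⟩
    1 + N + T * suc (4 * K)           ≤⟨ ℕ.+-mono-≤ (ℕ.+-mono-≤ 1≤T N≤T) ℕ.≤-refl ⟩
    T + T + T * suc (4 * K)           ≤⟨ ℕ.m≤m+n _ T ⟩
    T + T + T * suc (4 * K) + T       ≡⟨ collect T K ⟩
    4 * (T * suc K)                   ≤⟨ ℕ.*-monoʳ-≤ 4 (ℕ.m≤m*n (T * suc K) (suc n ℕ.⊓ suc K)) ⟩
    4 * (T * suc K * (N ℕ.⊓ suc K))   ∎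
    where
    open ℕ.≤-Reasoning
    N = suc n
    T = N * N
    N≤T : N ℕ.≤ T
    N≤T = ℕ.m≤m*n N N
    1≤T : 1 ℕ.≤ T
    1≤T = ℕ.≤-trans (s≤s z≤n) N≤T
    expand : ∀ N K → suc (N * suc (N * suc (2 * (K + K)))) ≡ 1 + N + N * N * suc (4 * K)
    expand = solve-∀
    collect : ∀ T K → T + T + T * suc (4 * K) + T ≡ 4 * (T * suc K)
    collect = solve-∀

open NatLemmas

module ArgmaxAndMinimum {a ℓ : Level} {A : Set a} {_≤_ : Rel A ℓ} (isTotalOrder : IsTotalOrder _≡_ _≤_) where

  open IsTotalOrder isTotalOrder
    using (total; antisym) renaming (refl to ≤-refl; reflexive to ≤-reflexive; trans to ≤-trans)

  private
    totalOrder : TotalOrder a a ℓ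
    totalOrder = record { isTotalOrder = isTotalOrder }

  open import Relation.Binary.Properties.TotalOrder totalOrder using (_<_; ≰⇒≥; <⇒≱)

  IsLeastArgmax : ∀ {n} → (Fin n → A) → Fin n → Set _
  IsLeastArgmax f b = (∀ j → f j ≤ f b) × (∀ j → j Fin.< b → f j < f b)

  leastArgmax : ∀ {n} (f : Fin (suc n) → A) → ¬ ¬ ∃ (IsLeastArgmax f)
  leastArgmax {zero}  f k = k (zero , (λ { zero → ≤-refl }) , λ _ ())
  leastArgmax {suc n} f k = leastArgmax (f ∘ suc) λ (b , max , least) →
    ¬¬-excluded-middle λ
      { (yes f[1+b]≤f0) → k (zero , (λ { zero → ≤-refl ; (suc j) → ≤-trans (max j) f[1+b]≤f0 }) , λ _ ())
      ; (no f[1+b]≰f0) → k (suc b , (λ { zero → ≰⇒≥ f[1+b]≰f0 ; (suc j) → max j })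
                          , λ { zero _ → ≰⇒≥ f[1+b]≰f0 , λ f0≡f[1+b] → f[1+b]≰f0 (≤-reflexive (sym f0≡f[1+b]))
                              ; (suc j) (ℕ.s≤s j<b) → least j j<b })
      }

  leastArgmax-unique : ∀ {n} {f : Fin n → A} {b b′} → IsLeastArgmax f b → IsLeastArgmax f b′ → b ≡ b′
  leastArgmax-unique {b = b} {b′} (max , least) (max′ , least′) with Fin.<-cmp b b′
  ... | tri< b<b′ _ _ = contradiction (max b′) (<⇒≱ (least′ b b<b′))
  ... | tri≈ _ b≡b′ _ = b≡b′
  ... | tri> _ _ b′<b = contradiction (max′ b) (<⇒≱ (least b′ b′<b))

  minimumWhere : ∀ {n} (p : Fin n → Bool) (f : Fin n → A) →
                 (∀ i → p i ≡ false) ⊎ ∃ λ k → p k ≡ true × (∀ i → p i ≡ true → f k ≤ f i)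
  minimumWhere {zero}  p f = inj₁ λ ()
  minimumWhere {suc n} p f with minimumWhere (p ∘ suc) (f ∘ suc) | p zero in p0
  ... | inj₁ none | false = inj₁ λ { zero → p0 ; (suc i) → none i }
  ... | inj₁ none | true  =
    inj₂ (zero , p0 , λ { zero _ → ≤-refl ; (suc i) pᵢ → contradiction (trans (sym pᵢ) (none i)) λ () })
  ... | inj₂ (k , pk , min) | false =
    inj₂ (suc k , pk , λ { zero p₀ → contradiction (trans (sym p₀) p0) λ () ; (suc i) → min i })
  ... | inj₂ (k , pk , min) | true with total (f zero) (f (suc k))
  ...   | inj₁ f0≤fk = inj₂ (zero , p0 , λ { zero _ → ≤-refl ; (suc i) pᵢ → ≤-trans f0≤fk (min i pᵢ) })
  ...   | inj₂ fk≤f0 = inj₂ (suc k , pk , λ { zero _ → fk≤f0 ; (suc i) → min i })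

module OrderedFieldProperties (F : OrderedField) where

  open OrderedField F
  open Tariff F using (fromℕ)

  commutativeRing : CommutativeRing _ _
  commutativeRing = record { isCommutativeRing = isCommutativeRing }

  totalOrder : TotalOrder _ _ _
  totalOrder = record { isTotalOrder = isTotalOrder }

  open CommutativeRing commutativeRing
    using (+-comm; +-assoc; +-identityˡ; +-identityʳ; -‿inverseʳ)
  open import Algebra.Properties.Ring (CommutativeRing.ring commutativeRing)
    using (-1*x≈-x; -‿involutive)
  open import Algebra.Properties.CommutativeSemigroup (CommutativeRing.+-commutativeSemigroup commutativeRing)
    using (xy∙z≈x∙zy; xy∙z≈xz∙y; x∙yz≈xz∙y; x∙yz≈y∙xz)
  open import Tactic.RingSolver.NonReflective (fromCommutativeRing commutativeRing (λ _ → nothing))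
    using (solve; _⊕_; _⊗_; _⊜_)
  open TotalOrder totalOrder using (total; antisym) renaming (refl to ≤-refl)
  open import Relation.Binary.Reasoning.PartialOrder (TotalOrder.poset totalOrder)

  +-monoʳ-≤ : ∀ {a b} c → a ≤ b → c + a ≤ c + b
  +-monoʳ-≤ {a} {b} c a≤b = subst₂ _≤_ (+-comm a c) (+-comm b c) (+-mono-≤ c a≤b)

  +-mono-≤₂ : ∀ {a b c d} → a ≤ b → c ≤ d → a + c ≤ b + d
  +-mono-≤₂ {a} {b} {c} {d} a≤b c≤d = begin
    a + c  ≤⟨ +-mono-≤ c a≤b ⟩
    b + c  ≤⟨ +-monoʳ-≤ b c≤d ⟩
    b + d  ∎

  +-negʳ-cancel : ∀ a c → a + c + - c ≡ a
  +-negʳ-cancel a c = begin-equality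
    a + c + - c    ≡⟨ +-assoc a c (- c) ⟩
    a + (c + - c)  ≡⟨ cong (a +_) (-‿inverseʳ c) ⟩
    a + 0#         ≡⟨ +-identityʳ a ⟩
    a              ∎

  +-cancelʳ-≤ : ∀ {a b} c → a + c ≤ b + c → a ≤ b
  +-cancelʳ-≤ {a} {b} c a+c≤b+c =
    subst₂ _≤_ (+-negʳ-cancel a c) (+-negʳ-cancel b c) (+-mono-≤ (- c) a+c≤b+c)

  ≤⇒∃nonneg-difference : ∀ {a b} → a ≤ b → ∃ λ d → 0# ≤ d × b ≡ a + d
  ≤⇒∃nonneg-difference {a} {b} a≤b =
    b + - a , subst (_≤ b + - a) (-‿inverseʳ a) (+-mono-≤ (- a) a≤b) , sym a+[b-a]≡b
    where
    a+[b-a]≡b : a + (b + - a) ≡ b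
    a+[b-a]≡b = begin-equality
      a + (b + - a)  ≡⟨ x∙yz≈y∙xz a b (- a) ⟩
      b + (a + - a)  ≡⟨ cong (b +_) (-‿inverseʳ a) ⟩
      b + 0#         ≡⟨ +-identityʳ b ⟩
      b              ∎

  0≤1 : 0# ≤ 1#
  0≤1 with total 0# 1#
  ... | inj₁ 0≤1 = 0≤1
  ... | inj₂ 1≤0 = contradiction (antisym 0≤1′ 1≤0) 0≢1
    where
    0≤-1 : 0# ≤ - 1#
    0≤-1 = subst₂ _≤_ (-‿inverseʳ 1#) (+-identityˡ (- 1#)) (+-mono-≤ (- 1#) 1≤0)
    0≤1′ : 0# ≤ 1#
    0≤1′ = subst (0# ≤_) (trans (-1*x≈-x (- 1#)) (-‿involutive 1#)) (*-nonneg 0≤-1 0≤-1)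

  fromℕ-mono : ∀ {m n} → m ℕ.≤ n → fromℕ m ≤ fromℕ n
  fromℕ-mono {n = zero}  z≤n     = ≤-refl
  fromℕ-mono {n = suc n} z≤n     =
    subst (_≤ fromℕ (suc n)) (+-identityˡ 0#) (+-mono-≤₂ 0≤1 (fromℕ-mono {n = n} z≤n))
  fromℕ-mono             (s≤s m≤n) = +-monoʳ-≤ 1# (fromℕ-mono m≤n)

  rearrangement : ∀ {x y Q Q′} → x ≤ y → Q ≤ Q′ → x * Q′ + y * Q ≤ x * Q + y * Q′
  rearrangement {x} {Q = Q} x≤y Q≤Q′
    with ≤⇒∃nonneg-difference x≤y | ≤⇒∃nonneg-difference Q≤Q′
  ... | d , 0≤d , refl | e , 0≤e , refl = begin
    x * (Q + e) + (x + d) * Q            ≡⟨ +-identityʳ _ ⟨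
    x * (Q + e) + (x + d) * Q + 0#       ≤⟨ +-monoʳ-≤ _ (*-nonneg 0≤d 0≤e) ⟩
    x * (Q + e) + (x + d) * Q + d * e    ≡⟨ expand ⟩
    x * Q + (x + d) * (Q + e)            ∎
    where
    expand : x * (Q + e) + (x + d) * Q + d * e ≡ x * Q + (x + d) * (Q + e)
    expand = solve 4 (λ x d Q e → (x ⊗ (Q ⊕ e) ⊕ (x ⊕ d) ⊗ Q ⊕ d ⊗ e) ⊜ (x ⊗ Q ⊕ (x ⊕ d) ⊗ (Q ⊕ e)))
                     refl x d Q e

  crossing-up : ∀ {x y Q Q′} A B → x ≤ y → Q ≤ Q′ → A + x * Q ≤ B + x * Q′ → A + y * Q ≤ B + y * Q′
  crossing-up {x} {y} {Q} {Q′} A B x≤y Q≤Q′ atx = +-cancelʳ-≤ (x * Q′) (begin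
    A + y * Q + x * Q′      ≡⟨ xy∙z≈x∙zy A (y * Q) (x * Q′) ⟩
    A + (x * Q′ + y * Q)    ≤⟨ +-monoʳ-≤ A (rearrangement x≤y Q≤Q′) ⟩
    A + (x * Q + y * Q′)    ≡⟨ +-assoc A (x * Q) (y * Q′) ⟨
    A + x * Q + y * Q′      ≤⟨ +-mono-≤ (y * Q′) atx ⟩
    B + x * Q′ + y * Q′     ≡⟨ xy∙z≈xz∙y B (x * Q′) (y * Q′) ⟩
    B + y * Q′ + x * Q′     ∎)

  crossing-down : ∀ {x y Q Q′} A B → x ≤ y → Q ≤ Q′ → A + y * Q′ ≤ B + y * Q → A + x * Q′ ≤ B + x * Q
  crossing-down {x} {y} {Q} {Q′} A B x≤y Q≤Q′ aty = +-cancelʳ-≤ (y * Q) (begin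
    A + x * Q′ + y * Q      ≡⟨ +-assoc A (x * Q′) (y * Q) ⟩
    A + (x * Q′ + y * Q)    ≤⟨ +-monoʳ-≤ A (rearrangement x≤y Q≤Q′) ⟩
    A + (x * Q + y * Q′)    ≡⟨ x∙yz≈xz∙y A (x * Q) (y * Q′) ⟩
    A + y * Q′ + x * Q      ≤⟨ +-mono-≤ (x * Q) aty ⟩
    B + y * Q + x * Q       ≡⟨ xy∙z≈xz∙y B (y * Q) (x * Q) ⟩
    B + x * Q + y * Q       ∎)

  x-y+[y+z]≡x+z : ∀ x y z → x + - y + (y + z) ≡ x + z
  x-y+[y+z]≡x+z x y z = begin-equality
    x + - y + (y + z)    ≡⟨ solve 4 (λ x y⁻ y z → (x ⊕ y⁻ ⊕ (y ⊕ z)) ⊜ (x ⊕ z ⊕ (y ⊕ y⁻)))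
                                    refl x (- y) y z ⟩
    x + z + (y + - y)    ≡⟨ cong (x + z +_) (-‿inverseʳ y) ⟩
    x + z + 0#           ≡⟨ +-identityʳ (x + z) ⟩
    x + z                ∎

implication⇒≤ : ∀ {x y} → (x ≡ true → y ≡ true) → x Bool.≤ y
implication⇒≤ {false} {false} _   = Bool.b≤b
implication⇒≤ {false} {true}  _   = Bool.f≤t
implication⇒≤ {true}  {true}  _   = Bool.b≤b
implication⇒≤ {true}  {false} x⇒y = contradiction (x⇒y refl) λ ()

not-antitone : ∀ {x y} → x Bool.≤ y → not y Bool.≤ not x
not-antitone Bool.b≤b = Bool.b≤b
not-antitone Bool.f≤t = Bool.f≤t

xor-injectiveʳ : ∀ c {x y} → c xor x ≡ c xor y → x ≡ y
xor-injectiveʳ true  = not-injective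
xor-injectiveʳ false = λ x≡y → x≡y

xor-antitone : ∀ {P : Set} (d : Dec P) {x y} →
               (P → x ≡ true → y ≡ true) → (¬ P → y ≡ true → x ≡ true) →
               ⌊ d ⌋ xor y Bool.≤ ⌊ d ⌋ xor x
xor-antitone (yes p)  x⇒y _   = not-antitone (implication⇒≤ (x⇒y p))
xor-antitone (no ¬p)  _   y⇒x = implication⇒≤ (y⇒x ¬p)

orient : ∀ {n} → Fin n → Fin n → Bool → Bool
orient α β x = ⌊ α Fin.<? β ⌋ xor x

isPurchase : ∀ {K} → Fin (suc K) → Bool
isPurchase zero    = false
isPurchase (suc _) = true

purchase : ∀ {K} → Bool → Fin K → Fin (suc K)
purchase false _ = zero
purchase true  j = suc j

module TariffProperties (F : OrderedField) where

  open OrderedField F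
  open Tariff F
  open OrderedFieldProperties F
  open ArgmaxAndMinimum isTotalOrder public
  open TotalOrder totalOrder using () renaming (trans to ≤-trans)
  open import Relation.Binary.Properties.TotalOrder totalOrder using (<⇒≱)
  open import Algebra.Properties.CommutativeSemigroup (CommutativeRing.+-commutativeSemigroup commutativeRing)
    using (xy∙z≈xz∙y)

  unitPrice : Tariff → Carrier
  unitPrice = proj₂

  utility-≤⇔ : ∀ {K K′} (v : Valuation K) (v′ : Valuation K′) ρ j j′ →
               utility v ρ j ≤ utility v′ ρ j′ ⇔
               v j + unitPrice ρ * fromℕ (qty j′) ≤ v′ j′ + unitPrice ρ * fromℕ (qty j)
  utility-≤⇔ v v′ (p₁ , p₂) j j′ = mk⇔
    (λ u≤u′ → subst₂ _≤_ shiftˡ shiftʳ (+-mono-≤ c u≤u′))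
    (λ h → +-cancelʳ-≤ c (subst₂ _≤_ (sym shiftˡ) (sym shiftʳ) h))
    where
    q = p₂ * fromℕ (qty j)
    q′ = p₂ * fromℕ (qty j′)
    c = p₁ + q + q′
    shiftˡ : utility v (p₁ , p₂) j + c ≡ v j + q′
    shiftˡ = x-y+[y+z]≡x+z (v j) (p₁ + q) q′
    shiftʳ : utility v′ (p₁ , p₂) j′ + c ≡ v′ j′ + q
    shiftʳ = trans (cong (utility v′ (p₁ , p₂) j′ +_) (xy∙z≈xz∙y p₁ q q′))
                   (x-y+[y+z]≡x+z (v′ j′) (p₁ + q′) q)

  utility-≤-raise : ∀ {K K′} (v : Valuation K) (v′ : Valuation K′) {ρ ρ′} {j j′} →
                    j′ Fin.≤ j → unitPrice ρ ≤ unitPrice ρ′ →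
                    utility v ρ j ≤ utility v′ ρ j′ → utility v ρ′ j ≤ utility v′ ρ′ j′
  utility-≤-raise v v′ {ρ} {ρ′} {j} {j′} j′≤j p≤p′ =
    Equivalence.from (utility-≤⇔ v v′ ρ′ j j′)
    ∘ crossing-up (v j) (v′ j′) p≤p′ (fromℕ-mono (s≤s j′≤j))
    ∘ Equivalence.to (utility-≤⇔ v v′ ρ j j′)

  utility-≤-lower : ∀ {K K′} (v : Valuation K) (v′ : Valuation K′) {ρ ρ′} {j j′} →
                    j Fin.≤ j′ → unitPrice ρ ≤ unitPrice ρ′ →
                    utility v ρ′ j ≤ utility v′ ρ′ j′ → utility v ρ j ≤ utility v′ ρ j′
  utility-≤-lower v v′ {ρ} {ρ′} {j} {j′} j≤j′ p≤p′ =
    Equivalence.from (utility-≤⇔ v v′ ρ j j′)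
    ∘ crossing-down (v j) (v′ j′) p≤p′ (fromℕ-mono (s≤s j≤j′))
    ∘ Equivalence.to (utility-≤⇔ v v′ ρ′ j j′)

  optimum-antitone : ∀ {K} (v : Valuation K) {ρ ρ′} {j j′} → unitPrice ρ ≤ unitPrice ρ′ →
                     IsLeastArgmax (utility v ρ) j → IsLeastArgmax (utility v ρ′) j′ → j′ Fin.≤ j
  optimum-antitone v {j = j} {j′} p≤p′ (max , _) (_ , least′) with j′ Fin.≤? j
  ... | yes j′≤j = j′≤j
  ... | no  j′≰j = contradiction (utility-≤-raise v v (ℕ.<⇒≤ j<j′) p≤p′ (max j′)) (<⇒≱ (least′ j j<j′))
    where j<j′ = ℕ.≰⇒> j′≰j

  Buys⇒q≡purchase : ∀ {K} {v : Valuation K} {ρ q j} →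
                     IsLeastArgmax (utility v ρ) j → Buys v ρ q → q ≡ purchase (isPurchase q) j
  Buys⇒q≡purchase _   (buy-nothing _)            = refl
  Buys⇒q≡purchase opt (buy-some _ _ max least) = cong suc (leastArgmax-unique (max , least) opt)

  Buys⇒isPurchase⇔0≤max : ∀ {K} {v : Valuation K} {ρ q j} → Buys v ρ q →
                           (∀ j′ → utility v ρ j′ ≤ utility v ρ j) →
                           isPurchase q ≡ true ⇔ 0# ≤ utility v ρ j
  Buys⇒isPurchase⇔0≤max {j = j} (buy-nothing negative) _ =
    mk⇔ (λ ()) (λ 0≤u → contradiction 0≤u (<⇒≱ (negative j)))
  Buys⇒isPurchase⇔0≤max (buy-some j′ 0≤u _ _) max = mk⇔ (λ _ → ≤-trans 0≤u (max j′)) (λ _ → refl)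

module PurchaseProfiles
  (F : OrderedField) {N K : ℕ} (vs : Fin N → Tariff.Valuation F (suc K))
  {m : ℕ} (ρs : Fin m → Tariff.Tariff F) (qs : Fin m → Fin N → Fin (suc (suc K)))
  (buys : ∀ a i → Tariff.Buys F (vs i) (ρs a) (qs a i))
  (optima : ∀ a i → ∃ (TariffProperties.IsLeastArgmax F (Tariff.utility F (vs i) (ρs a))))
  where

  open OrderedField F
  open Tariff F
  open OrderedFieldProperties F using (totalOrder)
  open TariffProperties F
  open TotalOrder totalOrder using (total) renaming (trans to ≤-trans)

  optimum : Fin m → Fin N → Fin (suc K)
  optimum a i = proj₁ (optima a i)

  surplus : Fin m → Fin N → Carrier
  surplus a i = utility (vs i) (ρs a) (optimum a i)

  buyer : Fin m → Fin N → Bool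
  buyer a i = isPurchase (qs a i)

  qs≡purchase : ∀ a i → qs a i ≡ purchase (buyer a i) (optimum a i)
  qs≡purchase a i = Buys⇒q≡purchase (proj₂ (optima a i)) (buys a i)

  buyer⇔0≤surplus : ∀ a i → buyer a i ≡ true ⇔ 0# ≤ surplus a i
  buyer⇔0≤surplus a i = Buys⇒isPurchase⇔0≤max (buys a i) (proj₁ (proj₂ (optima a i)))

  buyer-if-surplus-≥ : ∀ {a k i} → buyer a k ≡ true → surplus a k ≤ surplus a i → buyer a i ≡ true
  buyer-if-surplus-≥ {a} {k} {i} bought sk≤si =
    Equivalence.from (buyer⇔0≤surplus a i) (≤-trans (Equivalence.to (buyer⇔0≤surplus a k) bought) sk≤si)

  optimum-antitoneᵢ : ∀ {a b} i → unitPrice (ρs a) ≤ unitPrice (ρs b) → optimum b i Fin.≤ optimum a i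
  optimum-antitoneᵢ {a} {b} i a≤b = optimum-antitone (vs i) a≤b (proj₂ (optima a i)) (proj₂ (optima b i))

  -- Given a marginal buyer k, the buyers are exactly the samples whose surplus is at least k's.
  Marginal : Fin m → Fin N → Set
  Marginal a k = buyer a k ≡ true × (∀ i → buyer a i ≡ true → surplus a k ≤ surplus a i)

  -- The rank of i orders (optimum of i + optimum of k, purchase by i) lexicographically; the purchase
  -- bit is flipped when i's optimum lies below k's, since then buying becomes more likely as the
  -- unit price rises.
  rank : Fin m → Fin N → Fin N → ℕ
  rank a k i = lexRank (toℕ (optimum a i) ℕ.+ toℕ (optimum a k)) (orient (optimum a i) (optimum a k) (buyer a i))

  module SameMarginal {a b k} (a≤b : unitPrice (ρs a) ≤ unitPrice (ρs b))
                      (marginal-a : Marginal a k) (marginal-b : Marginal b k) where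

    buyer-rises : ∀ {i} → optimum a i ≡ optimum b i → optimum a k ≡ optimum b k →
                  optimum a i Fin.< optimum a k → buyer a i ≡ true → buyer b i ≡ true
    buyer-rises {i} αa≡αb βa≡βb α<β bought =
      buyer-if-surplus-≥ (proj₁ marginal-b)
        (subst₂ (λ α β → utility (vs k) (ρs b) β ≤ utility (vs i) (ρs b) α) αa≡αb βa≡βb
          (utility-≤-raise (vs k) (vs i) (ℕ.<⇒≤ α<β) a≤b (proj₂ marginal-a i bought)))

    buyer-falls : ∀ {i} → optimum a i ≡ optimum b i → optimum a k ≡ optimum b k →
                  optimum a k Fin.≤ optimum a i → buyer b i ≡ true → buyer a i ≡ true
    buyer-falls {i} αa≡αb βa≡βb β≤α bought =
      buyer-if-surplus-≥ (proj₁ marginal-a)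
        (utility-≤-lower (vs k) (vs i) β≤α a≤b
          (subst₂ (λ α β → utility (vs k) (ρs b) β ≤ utility (vs i) (ρs b) α) (sym αa≡αb) (sym βa≡βb)
            (proj₂ marginal-b i bought)))

    optimaSum-antitone : ∀ i → toℕ (optimum b i) ℕ.+ toℕ (optimum b k)
                                ℕ.≤ toℕ (optimum a i) ℕ.+ toℕ (optimum a k)
    optimaSum-antitone i = ℕ.+-mono-≤ (optimum-antitoneᵢ i a≤b) (optimum-antitoneᵢ k a≤b)

    equal-optima : ∀ i → toℕ (optimum b i) ℕ.+ toℕ (optimum b k) ≡ toℕ (optimum a i) ℕ.+ toℕ (optimum a k) →
                   optimum a i ≡ optimum b i × optimum a k ≡ optimum b k
    equal-optima i sums≡ with equal-sums⇒equal-summands (optimum-antitoneᵢ i a≤b) (optimum-antitoneᵢ k a≤b) sums≡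
    ... | αb≡αa , βb≡βa = sym (Fin.toℕ-injective αb≡αa) , sym (Fin.toℕ-injective βb≡βa)

    orient-transport : ∀ {i} x → optimum a i ≡ optimum b i × optimum a k ≡ optimum b k →
                       orient (optimum b i) (optimum b k) x ≡ orient (optimum a i) (optimum a k) x
    orient-transport x (α≡ , β≡) = cong₂ (λ α β → orient α β x) (sym α≡) (sym β≡)

    rank-antitone : ∀ i → rank b k i ℕ.≤ rank a k i
    rank-antitone i = lexRank-mono (optimaSum-antitone i) λ sums≡ →
      let optima≡ = equal-optima i sums≡ in
      subst (Bool._≤ orient (optimum a i) (optimum a k) (buyer a i)) (sym (orient-transport (buyer b i) optima≡))
        (xor-antitone (optimum a i Fin.<? optimum a k)
          (buyer-rises (proj₁ optima≡) (proj₂ optima≡))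
          (λ α≮β → buyer-falls (proj₁ optima≡) (proj₂ optima≡) (ℕ.≮⇒≥ α≮β)))

    rank-reflects : ∀ i → rank b k i ≡ rank a k i → qs b i ≡ qs a i
    rank-reflects i ranks≡ = begin
      qs b i                               ≡⟨ qs≡purchase b i ⟩
      purchase (buyer b i) (optimum b i)   ≡⟨ cong₂ purchase buyer≡ (sym (proj₁ optima≡)) ⟩
      purchase (buyer a i) (optimum a i)   ≡⟨ qs≡purchase a i ⟨
      qs a i                               ∎
      where
      open ≡-Reasoning
      reflected = lexRank-reflects (optimaSum-antitone i) ranks≡
      optima≡ = equal-optima i (proj₁ reflected)
      buyer≡ : buyer b i ≡ buyer a i
      buyer≡ = xor-injectiveʳ ⌊ optimum a i Fin.<? optimum a k ⌋
                 (trans (sym (orient-transport (buyer b i) optima≡)) (proj₂ reflected))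

    same-rankSum⇒same-profile : sum (rank a k) ≡ sum (rank b k) → ∀ i → qs a i ≡ qs b i
    same-rankSum⇒same-profile sums≡ i = sym (rank-reflects i (sum-≡⇒≡ rank-antitone (sym sums≡) i))

  rank-≤ : ∀ a k i → rank a k i ℕ.≤ suc (2 ℕ.* (K ℕ.+ K))
  rank-≤ a k i = ℕ.≤-trans
    (lexRank-≤ (toℕ (optimum a i) ℕ.+ toℕ (optimum a k)) (orient (optimum a i) (optimum a k) (buyer a i)))
    (s≤s (ℕ.*-monoʳ-≤ 2 (ℕ.+-mono-≤ (Fin.toℕ≤pred[n] (optimum a i)) (Fin.toℕ≤pred[n] (optimum a k)))))

  rankSum-< : ∀ a k → sum (rank a k) ℕ.< suc (N ℕ.* suc (2 ℕ.* (K ℕ.+ K)))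
  rankSum-< a k = s≤s (sum-≤ (rank-≤ a k))

  Classification : Fin m → Set
  Classification a = (∀ i → buyer a i ≡ false) ⊎ ∃ (Marginal a)

  classify : ∀ a → Classification a
  classify a = minimumWhere (buyer a) (surplus a)

  encode : ∀ a → Classification a → Fin (profileBound N K)
  encode a (inj₁ _)       = zero
  encode a (inj₂ (k , _)) = suc (Fin.combine k (Fin.fromℕ< (rankSum-< a k)))

  nobody-buys⇒qs≡zero : ∀ {a} → (∀ i → buyer a i ≡ false) → ∀ i → qs a i ≡ zero
  nobody-buys⇒qs≡zero {a} none i = trans (qs≡purchase a i) (cong (λ x → purchase x (optimum a i)) (none i))

  encode-injective : ∀ {a b} (ca : Classification a) (cb : Classification b) →
                     encode a ca ≡ encode b cb → ∀ i → qs a i ≡ qs b i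
  encode-injective (inj₁ none-a) (inj₁ none-b) _ i =
    trans (nobody-buys⇒qs≡zero none-a i) (sym (nobody-buys⇒qs≡zero none-b i))
  encode-injective {a} {b} (inj₂ (k , marginal-a)) (inj₂ (k′ , marginal-b)) codes≡
    with Fin.combine-injective k _ k′ _ (Fin.suc-injective codes≡)
  ... | refl , sums≡ with total (unitPrice (ρs a)) (unitPrice (ρs b))
  ...   | inj₁ a≤b = SameMarginal.same-rankSum⇒same-profile a≤b marginal-a marginal-b rankSums≡
    where rankSums≡ = Fin.fromℕ<-injective _ _ (rankSum-< a k) (rankSum-< b k) sums≡
  ...   | inj₂ b≤a = sym ∘ SameMarginal.same-rankSum⇒same-profile b≤a marginal-b marginal-a (sym rankSums≡)
    where rankSums≡ = Fin.fromℕ<-injective _ _ (rankSum-< a k) (rankSum-< b k) sums≡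

  distinct-profiles-bound : (∀ a b → (∀ i → qs a i ≡ qs b i) → a ≡ b) → m ℕ.≤ profileBound N K
  distinct-profiles-bound distinct =
    Fin.injective⇒≤ λ {a} {b} codes≡ → distinct a b (encode-injective (classify a) (classify b) codes≡)

¬¬-Π : ∀ {n p} {P : Fin n → Set p} → (∀ i → ¬ ¬ P i) → ¬ ¬ (∀ i → P i)
¬¬-Π {zero}  _   k = k λ ()
¬¬-Π {suc n} ¬¬P k = ¬¬P zero λ p₀ → ¬¬-Π (¬¬P ∘ suc) λ ps → k λ { zero → p₀ ; (suc i) → ps i }

module _ (F : OrderedField) where

  open Tariff F
  open TariffProperties F using (leastArgmax)

  -- Least argmaxima exist only classically, but m ≤ B is decidable, so they may be assumed.
  pieces-bound : ∀ {N K} (vs : Fin N → Valuation (suc K)) → PiecesAtMost vs (profileBound N K)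
  pieces-bound {N} {K} vs m ρs qs _ buys distinct =
    decidable-stable (m ℕ.≤? profileBound N K)
      (¬¬-map (λ optima → PurchaseProfiles.distinct-profiles-bound F vs ρs qs buys optima distinct)
        (¬¬-Π λ a → ¬¬-Π λ i → leastArgmax (utility (vs i) (ρs a))))

theorem7 : (F : OrderedField) →
    ∃ λ (C : ℕ) → ∀ (N K : ℕ) → 1 ℕ.≤ N → 1 ℕ.≤ K →
      (vs : Fin N → Tariff.Valuation F K) →
      (∀ i q → OrderedField._≤_ F (OrderedField.0# F) (vs i q)) →
      Tariff.PiecesAtMost F vs (C ℕ.* (N ℕ.* N ℕ.* K ℕ.* (N ℕ.⊓ K)))
theorem7 F = 4 , λ where
  zero    _       ()    _
  (suc n) zero    _     ()
  (suc n) (suc K) _ _ vs _ m ρs qs valid buys distinct →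
    ℕ.≤-trans (pieces-bound F vs m ρs qs valid buys distinct) (profileBound-≤ n K)
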